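{- Let $n\ge 2$, let $\pi$ be any permutation of $\{1,\ldots,n^2\}$ and let $x=(x_1,\ldots,x_{n^2})^T\in\mathbb{Z}^{n^2}$ with $1\le x_i\le n$ for $i=1,\ldots,n^2$ and $A_\pi x <> \mathbf{0}$. Then \[ x = \frac{1}{2}\left( A_\pi^T\, \mathrm{sgn}(A_\pi x) + (n+1)\mathbf{1}_{n^2}\right). \]
   Context: For $n\ge 1$ let $s(n)=n(n-1)/2$. The matrix $A(n)$ is the $s(n)\times n$ integer matrix whose rows are indexed by the pairs $(i,j)$ with $1\le i<j\le n$, in lexicographic order; the row for $(i,j)$ has entry $+1$ in column $i$, $-1$ in column $j$, and $0$ elsewhere. The matrix $A$ is the $n\,s(n)\times n^2$ block diagonal matrix with $n$ diagonal blocks each equal to $A(n)$ and zeros elsewhere. For a permutation $\pi$ of $\{1,\ldots,n^2\}$, $A_\pi$ is the matrix whose $j$-th column is the $\pi^{ -1}(j)$-th column of $A$. For $y\in\mathbb{Z}^s$, $y<>\mathbf{0}$ means every component of $y$ is nonzero, and for such $y$, $\mathrm{sgn}(y)=(\mathrm{sgn}(y_1),\ldots,\mathrm{sgn}(y_s))^T$. $\mathbf{1}_m$ is the all-ones vector in $\mathbb{Z}^m$. -}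

module Defs where

open import Data.Nat using (ℕ; zero; suc; _*_; _+_)
open import Data.Integer using (ℤ; +_; -[1+_]; +0; +[1+_]; -1ℤ; 0ℤ; 1ℤ; -_) renaming (_+_ to _+ℤ_; _*_ to _*ℤ_)
open import Data.Fin using (Fin)
open import Data.Fin.Permutation using (Permutation′; _⟨$⟩ˡ_)
open import Data.Vec using (Vec; []; _∷_; _++_; map; replicate; tabulate; lookup; zipWith; foldr; transpose)

Matrix : ℕ → ℕ → Set
Matrix m k = Vec (Vec ℤ k) m

-- s(n) = n(n-1)/2, given by the recursion s(0)=0, s(n+1) = n + s(n).
s : ℕ → ℕ
s zero = 0
s (suc n) = n + s n

unit : {n : ℕ} → Fin n → Vec ℤ n
unit k = tabulate (λ j → δ k j)
  where
  δ : {n : ℕ} → Fin n → Fin n → ℤ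
  δ Fin.zero Fin.zero = 1ℤ
  δ Fin.zero (Fin.suc _) = 0ℤ
  δ (Fin.suc _) Fin.zero = 0ℤ
  δ (Fin.suc a) (Fin.suc b) = δ a b

-- A(n): rows indexed by pairs (i,j), i<j, in lexicographic order; the row
-- for (i,j) is e_i - e_j.
Aₙ : (n : ℕ) → Matrix (s n) n
Aₙ zero = []
Aₙ (suc n) = tabulate (λ k → 1ℤ ∷ map -_ (unit k))
             ++ map (0ℤ ∷_) (Aₙ n)

blockDiag : {r c : ℕ} (b : ℕ) → Matrix r c → Matrix (b * r) (b * c)
blockDiag zero M = []
blockDiag {r} {c} (suc b) M =
  map (λ row → row ++ replicate (b * c) 0ℤ) M
  ++ map (λ row → replicate c 0ℤ ++ row) (blockDiag b M)

A : (n : ℕ) → Matrix (n * s n) (n * n)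
A n = blockDiag n (Aₙ n)

Aπ : (n : ℕ) → Permutation′ (n * n) → Matrix (n * s n) (n * n)
Aπ n π = map (λ row → tabulate (λ j → lookup row (π ⟨$⟩ˡ j))) (A n)

dot : {k : ℕ} → Vec ℤ k → Vec ℤ k → ℤ
dot u v = foldr _ _+ℤ_ 0ℤ (zipWith _*ℤ_ u v)

_·_ : {m k : ℕ} → Matrix m k → Vec ℤ k → Vec ℤ m
M · v = map (λ row → dot row v) M

_ᵀ : {m k : ℕ} → Matrix m k → Matrix k m
M ᵀ = transpose M

sgn : ℤ → ℤ
sgn +0 = 0ℤ
sgn +[1+ _ ] = 1ℤ
sgn -[1+ _ ] = -1ℤ

sgnᵥ : {m : ℕ} → Vec ℤ m → Vec ℤ m
sgnᵥ = map sgn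

-- If A(n) y has no zero entry then the entries of y are pairwise distinct, so when they lie in
-- {1, …, n} they are a permutation of 1, …, n.  The i-th entry of A(n)ᵀ sgn(A(n) y) is
-- Σⱼ sgn(yᵢ − yⱼ) = (yᵢ − 1) − (n − yᵢ) = 2yᵢ − (n + 1).  A is block diagonal, so this applies
-- block by block, and permuting the columns of A only reindexes x and the result:
-- A_π x = A y with y = x ∘ π, and A_πᵀ w is Aᵀ w reindexed by π⁻¹.
module Submission where

open import Defs
open import Data.Nat as ℕ using (ℕ; zero; suc; _≤_; _<_; _*_; s≤s)
import Data.Nat.Properties as ℕ
open import Data.Integer as ℤ
  using (ℤ; +_; 0ℤ; 1ℤ; -1ℤ; -_; _-_; +0; +[1+_]; -[1+_])
  renaming (_≤_ to _≤ℤ_; _+_ to _+ℤ_; _*_ to _*ℤ_)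
import Data.Integer.Properties as ℤ
open import Data.Integer.Tactic.RingSolver using (solve-∀)
open import Data.Fin as Fin using (Fin; toℕ)
import Data.Fin.Properties as Fin
open import Data.Fin.Permutation as Perm using (Permutation′; _⟨$⟩ʳ_; _⟨$⟩ˡ_)
open import Data.Vec using (Vec; []; _∷_; _++_; map; zipWith; replicate; lookup; tabulate; transpose; splitAt)
import Data.Vec.Properties as Vec
open import Data.Vec.Relation.Unary.All using (All)
import Data.Vec.Relation.Unary.All.Properties as All
open import Data.Product using (∃; _×_; _,_; proj₁; proj₂)
open import Data.Empty using (⊥-elim)
open import Function using (_∘_)
open import Function.Definitions using (Injective)
open import Relation.Nullary using (yes; no)
open import Relation.Binary.PropositionalEquality
  using (_≡_; _≢_; refl; sym; trans; cong; cong₂; subst; module ≡-Reasoning)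
open import Algebra.Properties.CommutativeMonoid.Sum ℤ.+-0-commutativeMonoid
  using (sum; sum-cong-≗; sum-permute; sum-replicate-zero)

open ≡-Reasoning

private variable
  m k r c : ℕ
  W X Y Z : Set

lookup-ext : {u v : Vec X m} → (∀ i → lookup u i ≡ lookup v i) → u ≡ v
lookup-ext {u = []}    {[]}    _  = refl
lookup-ext {u = _ ∷ _} {_ ∷ _} eq = cong₂ _∷_ (eq Fin.zero) (lookup-ext (eq ∘ Fin.suc))

rearrange : (Fin m → Fin k) → Vec X k → Vec X m
rearrange f v = tabulate (lookup v ∘ f)

lookup-rearrange : (f : Fin m → Fin k) (v : Vec X k) (i : Fin m) →
                   lookup (rearrange f v) i ≡ lookup v (f i)
lookup-rearrange f v = Vec.lookup∘tabulate (lookup v ∘ f)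

rearrange-map : (f : Fin m → Fin k) (g : X → Y) (v : Vec X k) →
                rearrange f (map g v) ≡ map g (rearrange f v)
rearrange-map f g v = lookup-ext λ i → begin
  lookup (rearrange f (map g v)) i ≡⟨ lookup-rearrange f (map g v) i ⟩
  lookup (map g v) (f i)           ≡⟨ Vec.lookup-map (f i) g v ⟩
  g (lookup v (f i))               ≡⟨ cong g (lookup-rearrange f v i) ⟨
  g (lookup (rearrange f v) i)     ≡⟨ Vec.lookup-map i g (rearrange f v) ⟨
  lookup (map g (rearrange f v)) i ∎

rearrange-zipWith : (f : Fin m → Fin k) (g : X → Y → Z) (u : Vec X k) (v : Vec Y k) →
                    rearrange f (zipWith g u v) ≡ zipWith g (rearrange f u) (rearrange f v)
rearrange-zipWith f g u v = lookup-ext λ i → begin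
  lookup (rearrange f (zipWith g u v)) i            ≡⟨ lookup-rearrange f (zipWith g u v) i ⟩
  lookup (zipWith g u v) (f i)                      ≡⟨ Vec.lookup-zipWith g (f i) u v ⟩
  g (lookup u (f i)) (lookup v (f i))               ≡⟨ cong₂ g (lookup-rearrange f u i) (lookup-rearrange f v i) ⟨
  g (lookup (rearrange f u) i) (lookup (rearrange f v) i)
    ≡⟨ Vec.lookup-zipWith g i (rearrange f u) (rearrange f v) ⟨
  lookup (zipWith g (rearrange f u) (rearrange f v)) i ∎

rearrange-replicate : (f : Fin m → Fin k) (x : X) → rearrange f (replicate k x) ≡ replicate m x
rearrange-replicate f x = lookup-ext λ i → begin
  lookup (rearrange f (replicate _ x)) i ≡⟨ lookup-rearrange f (replicate _ x) i ⟩
  lookup (replicate _ x) (f i)           ≡⟨ Vec.lookup-replicate (f i) x ⟩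
  x                                      ≡⟨ Vec.lookup-replicate i x ⟨
  lookup (replicate _ x) i               ∎

rearrange-inverse : (f : Fin m → Fin k) (g : Fin k → Fin m) → (∀ i → f (g i) ≡ i) →
                    (v : Vec X k) → rearrange g (rearrange f v) ≡ v
rearrange-inverse f g f∘g≗id v = lookup-ext λ i → begin
  lookup (rearrange g (rearrange f v)) i ≡⟨ lookup-rearrange g (rearrange f v) i ⟩
  lookup (rearrange f v) (g i)           ≡⟨ lookup-rearrange f v (g i) ⟩
  lookup v (f (g i))                     ≡⟨ cong (lookup v) (f∘g≗id i) ⟩
  lookup v i                             ∎

dot-sum : (u v : Vec ℤ m) → dot u v ≡ sum (λ i → lookup u i *ℤ lookup v i)
dot-sum []      []      = refl
dot-sum (a ∷ u) (b ∷ v) = cong (a *ℤ b +ℤ_) (dot-sum u v)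

dot-++ : (u : Vec ℤ m) (u′ : Vec ℤ k) (v : Vec ℤ m) (v′ : Vec ℤ k) →
         dot (u ++ u′) (v ++ v′) ≡ dot u v +ℤ dot u′ v′
dot-++ []      u′ []      v′ = sym (ℤ.+-identityˡ (dot u′ v′))
dot-++ (a ∷ u) u′ (b ∷ v) v′ = begin
  a *ℤ b +ℤ dot (u ++ u′) (v ++ v′)   ≡⟨ cong (a *ℤ b +ℤ_) (dot-++ u u′ v v′) ⟩
  a *ℤ b +ℤ (dot u v +ℤ dot u′ v′)    ≡⟨ ℤ.+-assoc (a *ℤ b) (dot u v) (dot u′ v′) ⟨
  a *ℤ b +ℤ dot u v +ℤ dot u′ v′      ∎

dot-zeroˡ : (v : Vec ℤ m) → dot (replicate m 0ℤ) v ≡ 0ℤ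
dot-zeroˡ []      = refl
dot-zeroˡ (_ ∷ v) = trans (ℤ.+-identityˡ _) (dot-zeroˡ v)

dot-negˡ : (u v : Vec ℤ m) → dot (map -_ u) v ≡ - dot u v
dot-negˡ []      []      = refl
dot-negˡ (a ∷ u) (b ∷ v) = begin
  - a *ℤ b +ℤ dot (map -_ u) v   ≡⟨ cong (- a *ℤ b +ℤ_) (dot-negˡ u v) ⟩
  - a *ℤ b +ℤ - dot u v          ≡⟨ lemma a b (dot u v) ⟩
  - (a *ℤ b +ℤ dot u v)          ∎
  where
  lemma : ∀ a b d → - a *ℤ b +ℤ - d ≡ - (a *ℤ b +ℤ d)
  lemma = solve-∀

dot-unit : (i : Fin m) (v : Vec ℤ m) → dot (unit i) v ≡ lookup v i
dot-unit Fin.zero    (b ∷ v) = begin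
  1ℤ *ℤ b +ℤ dot (tabulate λ _ → 0ℤ) v ≡⟨ cong (λ z → 1ℤ *ℤ b +ℤ dot z v) zeros ⟩
  1ℤ *ℤ b +ℤ dot (replicate _ 0ℤ) v    ≡⟨ cong (1ℤ *ℤ b +ℤ_) (dot-zeroˡ v) ⟩
  1ℤ *ℤ b +ℤ 0ℤ                        ≡⟨ ℤ.+-identityʳ (1ℤ *ℤ b) ⟩
  1ℤ *ℤ b                              ≡⟨ ℤ.*-identityˡ b ⟩
  b                                    ∎
  where
  zeros : tabulate (λ _ → 0ℤ) ≡ replicate _ 0ℤ
  zeros = lookup-ext λ i → trans (Vec.lookup∘tabulate _ i) (sym (Vec.lookup-replicate i 0ℤ))
dot-unit (Fin.suc i) (b ∷ v) = trans (ℤ.+-identityˡ (dot (unit i) v)) (dot-unit i v)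

dot-rearrange : (π : Permutation′ m) (u v : Vec ℤ m) →
                dot (rearrange (π ⟨$⟩ˡ_) u) v ≡ dot u (rearrange (π ⟨$⟩ʳ_) v)
dot-rearrange π u v = begin
  dot (rearrange (π ⟨$⟩ˡ_) u) v
    ≡⟨ dot-sum (rearrange (π ⟨$⟩ˡ_) u) v ⟩
  sum (λ j → lookup (rearrange (π ⟨$⟩ˡ_) u) j *ℤ lookup v j)
    ≡⟨ sum-cong-≗ (λ j → cong (_*ℤ lookup v j) (lookup-rearrange (π ⟨$⟩ˡ_) u j)) ⟩
  sum (λ j → lookup u (π ⟨$⟩ˡ j) *ℤ lookup v j)
    ≡⟨ sum-permute (λ j → lookup u (π ⟨$⟩ˡ j) *ℤ lookup v j) π ⟩
  sum (λ i → lookup u (π ⟨$⟩ˡ (π ⟨$⟩ʳ i)) *ℤ lookup v (π ⟨$⟩ʳ i))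
    ≡⟨ sum-cong-≗ (λ i → cong₂ _*ℤ_ (cong (lookup u) (Perm.inverseˡ π))
                                    (sym (lookup-rearrange (π ⟨$⟩ʳ_) v i))) ⟩
  sum (λ i → lookup u i *ℤ lookup (rearrange (π ⟨$⟩ʳ_) v) i)
    ≡⟨ dot-sum u (rearrange (π ⟨$⟩ʳ_) v) ⟨
  dot u (rearrange (π ⟨$⟩ʳ_) v) ∎

sum-unit : (j : Fin m) (f : Fin m → ℤ) → sum (λ i → lookup (unit i) j *ℤ f i) ≡ f j
sum-unit {suc m} Fin.zero f = begin
  1ℤ *ℤ f Fin.zero +ℤ sum {m} (λ _ → 0ℤ) ≡⟨ cong (1ℤ *ℤ f Fin.zero +ℤ_) (sum-replicate-zero m) ⟩
  1ℤ *ℤ f Fin.zero +ℤ 0ℤ                 ≡⟨ ℤ.+-identityʳ _ ⟩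
  1ℤ *ℤ f Fin.zero                       ≡⟨ ℤ.*-identityˡ _ ⟩
  f Fin.zero                             ∎
sum-unit (Fin.suc j) f = begin
  lookup (tabulate λ _ → 0ℤ) j *ℤ f Fin.zero +ℤ S
    ≡⟨ cong (λ z → z *ℤ f Fin.zero +ℤ S) (Vec.lookup∘tabulate (λ _ → 0ℤ) j) ⟩
  0ℤ +ℤ S ≡⟨ ℤ.+-identityˡ S ⟩
  S       ≡⟨ sum-unit j (f ∘ Fin.suc) ⟩
  f (Fin.suc j) ∎
  where S = sum (λ i → lookup (unit i) j *ℤ f (Fin.suc i))

injective⇒surjective : {g : Fin m → Fin m} → Injective _≡_ _≡_ g → ∀ j → ∃ λ i → g i ≡ j
injective⇒surjective {suc m} {g} g-inj j with Fin.any? (λ i → g i Fin.≟ j)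
... | yes hit = hit
... | no miss = ⊥-elim (ℕ.1+n≰n (Fin.injective⇒≤ squeeze-inj))
  where
  -- Missing j, g would inject Fin (suc m) into Fin m.
  j≢g : ∀ i → j ≢ g i
  j≢g i j≡gi = miss (i , sym j≡gi)
  squeeze : Fin (suc m) → Fin m
  squeeze i = Fin.punchOut (j≢g i)
  squeeze-inj : Injective _≡_ _≡_ squeeze
  squeeze-inj eq = g-inj (Fin.punchOut-injective (j≢g _) (j≢g _) eq)

sum-∘-injective : (f : Fin m → ℤ) {g : Fin m → Fin m} → Injective _≡_ _≡_ g →
                  sum (f ∘ g) ≡ sum f
sum-∘-injective f {g} g-inj = sym (sum-permute f π)
  where
  g⁻¹ : Fin _ → Fin _
  g⁻¹ j = proj₁ (injective⇒surjective g-inj j)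
  π : Permutation′ _
  π = Perm.permutation g g⁻¹ (proj₂ ∘ injective⇒surjective g-inj)
                             (λ i → g-inj (proj₂ (injective⇒surjective g-inj (g i))))

sum-minus-ones : ∀ n → sum {n} (λ _ → -1ℤ) +ℤ + n ≡ 0ℤ
sum-minus-ones zero    = refl
sum-minus-ones (suc n) = begin
  -1ℤ +ℤ S +ℤ (+ 1 +ℤ + n) ≡⟨ lemma S (+ n) ⟩
  S +ℤ + n                 ≡⟨ sum-minus-ones n ⟩
  0ℤ                       ∎
  where
  S = sum {n} (λ _ → -1ℤ)
  lemma : ∀ s n → -1ℤ +ℤ s +ℤ (+ 1 +ℤ n) ≡ s +ℤ n
  lemma = solve-∀

-- Among 1, …, n the value suc t lies above t of them and below n ∸ suc t of them.
sum-sgn-1…n : ∀ n t → t < n →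
              sum {n} (λ a → sgn (+ suc t - + suc (toℕ a))) +ℤ + suc n ≡ + 2 *ℤ + suc t
sum-sgn-1…n (suc n) zero    _ = begin
  0ℤ +ℤ S +ℤ (+ 2 +ℤ + n) ≡⟨ lemma S (+ n) ⟩
  S +ℤ + n +ℤ + 2         ≡⟨ cong (_+ℤ + 2) (sum-minus-ones n) ⟩
  + 2                     ∎
  where
  S = sum {n} (λ _ → -1ℤ)
  lemma : ∀ s n → 0ℤ +ℤ s +ℤ (+ 2 +ℤ n) ≡ s +ℤ n +ℤ + 2
  lemma = solve-∀
sum-sgn-1…n (suc n) (suc t) (s≤s t<n) = begin
  1ℤ +ℤ S′ +ℤ (+ 1 +ℤ + suc n) ≡⟨ cong (λ z → 1ℤ +ℤ z +ℤ (+ 1 +ℤ + suc n)) (sum-cong-≗ {n} λ a → cong sgn (shift (suc t) (suc (toℕ a)))) ⟩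
  1ℤ +ℤ S +ℤ (+ 1 +ℤ + suc n)  ≡⟨ lemma₁ S (+ suc n) ⟩
  + 2 +ℤ (S +ℤ + suc n)        ≡⟨ cong (+ 2 +ℤ_) (sum-sgn-1…n n t t<n) ⟩
  + 2 +ℤ + 2 *ℤ + suc t        ≡⟨ lemma₂ (+ suc t) ⟩
  + 2 *ℤ (+ 1 +ℤ + suc t)      ∎
  where
  S′ = sum {n} (λ a → sgn (+ suc (suc t) - + suc (suc (toℕ a))))
  S  = sum {n} (λ a → sgn (+ suc t - + suc (toℕ a)))
  shift : ∀ t a → + suc t - + suc a ≡ + t - + a
  shift t a = lemma (+ t) (+ a)
    where
    lemma : ∀ t a → + 1 +ℤ t - (+ 1 +ℤ a) ≡ t - a
    lemma = solve-∀
  lemma₁ : ∀ s n → 1ℤ +ℤ s +ℤ (+ 1 +ℤ n) ≡ + 2 +ℤ (s +ℤ n)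
  lemma₁ = solve-∀
  lemma₂ : ∀ t → + 2 +ℤ + 2 *ℤ t ≡ + 2 *ℤ (+ 1 +ℤ t)
  lemma₂ = solve-∀

replicate-++ : (x : X) → replicate (m ℕ.+ k) x ≡ replicate m x ++ replicate k x
replicate-++ {m = zero}  x = refl
replicate-++ {m = suc m} x = cong (x ∷_) (replicate-++ {m = m} x)

map-zipWith : (f : Z → W) (g : X → Y → Z) (u : Vec X m) (v : Vec Y m) →
              map f (zipWith g u v) ≡ zipWith (λ x y → f (g x y)) u v
map-zipWith f g []      []      = refl
map-zipWith f g (x ∷ u) (y ∷ v) = cong (f (g x y) ∷_) (map-zipWith f g u v)

-- Mᵀ w as the combination Σᵣ wᵣ · (row r of M), by recursion on the rows; this is the form in
-- which the row-block structure of Aₙ and blockDiag can be used.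
combineRows : Matrix m k → Vec ℤ m → Vec ℤ k
combineRows []        []      = replicate _ 0ℤ
combineRows (row ∷ M) (a ∷ w) = zipWith _+ℤ_ (map (_*ℤ a) row) (combineRows M w)

ᵀ·≡combineRows : (M : Matrix m k) (w : Vec ℤ m) → (M ᵀ) · w ≡ combineRows M w
ᵀ·≡combineRows {k = k} []        []      = Vec.map-replicate (λ col → dot col []) [] k
ᵀ·≡combineRows         (row ∷ M) (a ∷ w) = begin
  map (λ col → dot col (a ∷ w)) (transpose (row ∷ M))
    ≡⟨ cong (map (λ col → dot col (a ∷ w))) (Vec.zipWith-is-⊛ _∷_ row (transpose M)) ⟨
  map (λ col → dot col (a ∷ w)) (zipWith _∷_ row (transpose M))
    ≡⟨ map-zipWith (λ col → dot col (a ∷ w)) _∷_ row (transpose M) ⟩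
  zipWith (λ x col → x *ℤ a +ℤ dot col w) row (transpose M)
    ≡⟨ Vec.zipWith-map₂ (λ x y → x *ℤ a +ℤ y) (λ col → dot col w) row (transpose M) ⟨
  zipWith (λ x y → x *ℤ a +ℤ y) row ((M ᵀ) · w)
    ≡⟨ Vec.zipWith-map₁ _+ℤ_ (_*ℤ a) row ((M ᵀ) · w) ⟨
  zipWith _+ℤ_ (map (_*ℤ a) row) ((M ᵀ) · w)
    ≡⟨ cong (zipWith _+ℤ_ (map (_*ℤ a) row)) (ᵀ·≡combineRows M w) ⟩
  combineRows (row ∷ M) (a ∷ w) ∎

lookup-combineRows : (M : Matrix m k) (w : Vec ℤ m) (j : Fin k) →
                     lookup (combineRows M w) j ≡ sum (λ r → lookup (lookup M r) j *ℤ lookup w r)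
lookup-combineRows []        []      j = Vec.lookup-replicate j 0ℤ
lookup-combineRows (row ∷ M) (a ∷ w) j = begin
  lookup (zipWith _+ℤ_ (map (_*ℤ a) row) (combineRows M w)) j
    ≡⟨ Vec.lookup-zipWith _+ℤ_ j (map (_*ℤ a) row) (combineRows M w) ⟩
  lookup (map (_*ℤ a) row) j +ℤ lookup (combineRows M w) j
    ≡⟨ cong₂ _+ℤ_ (Vec.lookup-map j (_*ℤ a) row) (lookup-combineRows M w j) ⟩
  lookup row j *ℤ a +ℤ sum (λ r → lookup (lookup M r) j *ℤ lookup w r) ∎

combineRows-++ : (P : Matrix m k) (Q : Matrix r k) (v : Vec ℤ m) (w : Vec ℤ r) →
                 combineRows (P ++ Q) (v ++ w) ≡ zipWith _+ℤ_ (combineRows P v) (combineRows Q w)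
combineRows-++ []        Q []      w = sym (Vec.zipWith-identityˡ ℤ.+-identityˡ (combineRows Q w))
combineRows-++ (row ∷ P) Q (a ∷ v) w = begin
  zipWith _+ℤ_ (map (_*ℤ a) row) (combineRows (P ++ Q) (v ++ w))
    ≡⟨ cong (zipWith _+ℤ_ (map (_*ℤ a) row)) (combineRows-++ P Q v w) ⟩
  zipWith _+ℤ_ (map (_*ℤ a) row) (zipWith _+ℤ_ (combineRows P v) (combineRows Q w))
    ≡⟨ Vec.zipWith-assoc ℤ.+-assoc (map (_*ℤ a) row) (combineRows P v) (combineRows Q w) ⟨
  zipWith _+ℤ_ (combineRows (row ∷ P) (a ∷ v)) (combineRows Q w) ∎

combineRows-columns : (P : Matrix m c) (Q : Matrix m k) (w : Vec ℤ m) →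
                      combineRows (zipWith _++_ P Q) w ≡ combineRows P w ++ combineRows Q w
combineRows-columns {c = c} []          []          []      = replicate-++ {m = c} 0ℤ
combineRows-columns         (row ∷ P) (row′ ∷ Q) (a ∷ w) = begin
  zipWith _+ℤ_ (map (_*ℤ a) (row ++ row′)) (combineRows (zipWith _++_ P Q) w)
    ≡⟨ cong₂ (zipWith _+ℤ_) (Vec.map-++ (_*ℤ a) row row′) (combineRows-columns P Q w) ⟩
  zipWith _+ℤ_ (map (_*ℤ a) row ++ map (_*ℤ a) row′) (combineRows P w ++ combineRows Q w)
    ≡⟨ Vec.zipWith-++ _+ℤ_ (map (_*ℤ a) row) (map (_*ℤ a) row′) (combineRows P w) (combineRows Q w) ⟩
  combineRows (row ∷ P) (a ∷ w) ++ combineRows (row′ ∷ Q) (a ∷ w) ∎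

combineRows-zero : (w : Vec ℤ m) → combineRows (replicate m (replicate k 0ℤ)) w ≡ replicate k 0ℤ
combineRows-zero         []      = refl
combineRows-zero {k = k} (a ∷ w) = begin
  zipWith _+ℤ_ (map (_*ℤ a) (replicate k 0ℤ)) (combineRows (replicate _ (replicate k 0ℤ)) w)
    ≡⟨ cong₂ (zipWith _+ℤ_) (Vec.map-replicate (_*ℤ a) 0ℤ k) (combineRows-zero w) ⟩
  zipWith _+ℤ_ (replicate k 0ℤ) (replicate k 0ℤ)
    ≡⟨ Vec.zipWith-identityˡ ℤ.+-identityˡ (replicate k 0ℤ) ⟩
  replicate k 0ℤ ∎

combineRows-padʳ : (P : Matrix m c) (w : Vec ℤ m) →
                   combineRows (map (_++ replicate k 0ℤ) P) w ≡ combineRows P w ++ replicate k 0ℤ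
combineRows-padʳ {k = k} P w = begin
  combineRows (map (_++ replicate k 0ℤ) P) w
    ≡⟨ cong (λ M → combineRows M w) (Vec.zipWith-replicate₂ _++_ P (replicate k 0ℤ)) ⟨
  combineRows (zipWith _++_ P (replicate _ (replicate k 0ℤ))) w
    ≡⟨ combineRows-columns P (replicate _ (replicate k 0ℤ)) w ⟩
  combineRows P w ++ combineRows (replicate _ (replicate k 0ℤ)) w
    ≡⟨ cong (combineRows P w ++_) (combineRows-zero w) ⟩
  combineRows P w ++ replicate k 0ℤ ∎

combineRows-padˡ : (c : ℕ) (Q : Matrix m k) (w : Vec ℤ m) →
                   combineRows (map (replicate c 0ℤ ++_) Q) w ≡ replicate c 0ℤ ++ combineRows Q w
combineRows-padˡ c Q w = begin
  combineRows (map (replicate c 0ℤ ++_) Q) w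
    ≡⟨ cong (λ M → combineRows M w) (Vec.zipWith-replicate₁ _++_ (replicate c 0ℤ) Q) ⟨
  combineRows (zipWith _++_ (replicate _ (replicate c 0ℤ)) Q) w
    ≡⟨ combineRows-columns (replicate _ (replicate c 0ℤ)) Q w ⟩
  combineRows (replicate _ (replicate c 0ℤ)) w ++ combineRows Q w
    ≡⟨ cong (_++ combineRows Q w) (combineRows-zero w) ⟩
  replicate c 0ℤ ++ combineRows Q w ∎

combineRows-rearrange : (f : Fin c → Fin k) (M : Matrix m k) (w : Vec ℤ m) →
                        combineRows (map (rearrange f) M) w ≡ rearrange f (combineRows M w)
combineRows-rearrange f []        []      = sym (rearrange-replicate f 0ℤ)
combineRows-rearrange f (row ∷ M) (a ∷ w) = begin
  zipWith _+ℤ_ (map (_*ℤ a) (rearrange f row)) (combineRows (map (rearrange f) M) w)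
    ≡⟨ cong₂ (zipWith _+ℤ_) (sym (rearrange-map f (_*ℤ a) row)) (combineRows-rearrange f M w) ⟩
  zipWith _+ℤ_ (rearrange f (map (_*ℤ a) row)) (rearrange f (combineRows M w))
    ≡⟨ rearrange-zipWith f _+ℤ_ (map (_*ℤ a) row) (combineRows M w) ⟨
  rearrange f (combineRows (row ∷ M) (a ∷ w)) ∎

·-permuteColumns : (π : Permutation′ k) (M : Matrix m k) (v : Vec ℤ k) →
                   map (rearrange (π ⟨$⟩ˡ_)) M · v ≡ M · rearrange (π ⟨$⟩ʳ_) v
·-permuteColumns π M v = begin
  map (λ row → dot row v) (map (rearrange (π ⟨$⟩ˡ_)) M)
    ≡⟨ Vec.map-∘ (λ row → dot row v) (rearrange (π ⟨$⟩ˡ_)) M ⟨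
  map (λ row → dot (rearrange (π ⟨$⟩ˡ_) row) v) M
    ≡⟨ Vec.map-cong (λ row → dot-rearrange π row v) M ⟩
  M · rearrange (π ⟨$⟩ʳ_) v ∎

ᵀ·-permuteColumns : (f : Fin c → Fin k) (M : Matrix m k) (w : Vec ℤ m) →
                    (map (rearrange f) M ᵀ) · w ≡ rearrange f ((M ᵀ) · w)
ᵀ·-permuteColumns f M w = begin
  (map (rearrange f) M ᵀ) · w      ≡⟨ ᵀ·≡combineRows (map (rearrange f) M) w ⟩
  combineRows (map (rearrange f) M) w ≡⟨ combineRows-rearrange f M w ⟩
  rearrange f (combineRows M w)    ≡⟨ cong (rearrange f) (ᵀ·≡combineRows M w) ⟨
  rearrange f ((M ᵀ) · w)          ∎

·-blockDiag : (b : ℕ) (M : Matrix r c) (u : Vec ℤ c) (v : Vec ℤ (b * c)) →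
              blockDiag (suc b) M · (u ++ v) ≡ (M · u) ++ (blockDiag b M · v)
·-blockDiag {c = c} b M u v = begin
  map (λ row → dot row (u ++ v)) (map (_++ replicate (b * c) 0ℤ) M ++ map (replicate c 0ℤ ++_) (blockDiag b M))
    ≡⟨ Vec.map-++ (λ row → dot row (u ++ v)) (map (_++ replicate (b * c) 0ℤ) M) (map (replicate c 0ℤ ++_) (blockDiag b M)) ⟩
  map (λ row → dot row (u ++ v)) (map (_++ replicate (b * c) 0ℤ) M)
    ++ map (λ row → dot row (u ++ v)) (map (replicate c 0ℤ ++_) (blockDiag b M))
    ≡⟨ cong₂ _++_ (trans (sym (Vec.map-∘ _ _ M)) (Vec.map-cong upper M))
                  (trans (sym (Vec.map-∘ _ _ (blockDiag b M))) (Vec.map-cong lower (blockDiag b M))) ⟩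
  (M · u) ++ (blockDiag b M · v) ∎
  where
  upper : ∀ row → dot (row ++ replicate (b * c) 0ℤ) (u ++ v) ≡ dot row u
  upper row = begin
    dot (row ++ replicate (b * c) 0ℤ) (u ++ v) ≡⟨ dot-++ row (replicate (b * c) 0ℤ) u v ⟩
    dot row u +ℤ dot (replicate (b * c) 0ℤ) v ≡⟨ cong (dot row u +ℤ_) (dot-zeroˡ v) ⟩
    dot row u +ℤ 0ℤ                          ≡⟨ ℤ.+-identityʳ (dot row u) ⟩
    dot row u ∎
  lower : ∀ row → dot (replicate c 0ℤ ++ row) (u ++ v) ≡ dot row v
  lower row = begin
    dot (replicate c 0ℤ ++ row) (u ++ v) ≡⟨ dot-++ (replicate c 0ℤ) row u v ⟩
    dot (replicate c 0ℤ) u +ℤ dot row v  ≡⟨ cong (_+ℤ dot row v) (dot-zeroˡ u) ⟩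
    0ℤ +ℤ dot row v                      ≡⟨ ℤ.+-identityˡ (dot row v) ⟩
    dot row v ∎

ᵀ·-blockDiag : (b : ℕ) (M : Matrix r c) (w : Vec ℤ r) (w′ : Vec ℤ (b * r)) →
               (blockDiag (suc b) M ᵀ) · (w ++ w′) ≡ ((M ᵀ) · w) ++ ((blockDiag b M ᵀ) · w′)
ᵀ·-blockDiag {c = c} b M w w′ = begin
  (blockDiag (suc b) M ᵀ) · (w ++ w′)
    ≡⟨ ᵀ·≡combineRows (blockDiag (suc b) M) (w ++ w′) ⟩
  combineRows (map (_++ replicate (b * c) 0ℤ) M ++ map (replicate c 0ℤ ++_) (blockDiag b M)) (w ++ w′)
    ≡⟨ combineRows-++ (map (_++ replicate (b * c) 0ℤ) M) (map (replicate c 0ℤ ++_) (blockDiag b M)) w w′ ⟩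
  zipWith _+ℤ_ (combineRows (map (_++ replicate (b * c) 0ℤ) M) w)
               (combineRows (map (replicate c 0ℤ ++_) (blockDiag b M)) w′)
    ≡⟨ cong₂ (zipWith _+ℤ_) (combineRows-padʳ M w) (combineRows-padˡ c (blockDiag b M) w′) ⟩
  zipWith _+ℤ_ (combineRows M w ++ replicate (b * c) 0ℤ) (replicate c 0ℤ ++ combineRows (blockDiag b M) w′)
    ≡⟨ Vec.zipWith-++ _+ℤ_ (combineRows M w) (replicate (b * c) 0ℤ) (replicate c 0ℤ) (combineRows (blockDiag b M) w′) ⟩
  zipWith _+ℤ_ (combineRows M w) (replicate c 0ℤ) ++ zipWith _+ℤ_ (replicate (b * c) 0ℤ) (combineRows (blockDiag b M) w′)
    ≡⟨ cong₂ _++_ (Vec.zipWith-identityʳ ℤ.+-identityʳ (combineRows M w))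
                  (Vec.zipWith-identityˡ ℤ.+-identityˡ (combineRows (blockDiag b M) w′)) ⟩
  combineRows M w ++ combineRows (blockDiag b M) w′
    ≡⟨ cong₂ _++_ (ᵀ·≡combineRows M w) (ᵀ·≡combineRows (blockDiag b M) w′) ⟨
  ((M ᵀ) · w) ++ ((blockDiag b M ᵀ) · w′) ∎

Aₙ-suc-· : (y₀ : ℤ) (y : Vec ℤ m) →
           Aₙ (suc m) · (y₀ ∷ y) ≡ tabulate (λ i → y₀ - lookup y i) ++ (Aₙ m · y)
Aₙ-suc-· {m} y₀ y = begin
  map dotY (tabulate firstRow ++ map (0ℤ ∷_) (Aₙ m))
    ≡⟨ Vec.map-++ dotY (tabulate firstRow) (map (0ℤ ∷_) (Aₙ m)) ⟩
  map dotY (tabulate firstRow) ++ map dotY (map (0ℤ ∷_) (Aₙ m))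
    ≡⟨ cong₂ _++_ (trans (sym (Vec.tabulate-∘ dotY firstRow)) (Vec.tabulate-cong first))
                  (trans (sym (Vec.map-∘ dotY (0ℤ ∷_) (Aₙ m))) (Vec.map-cong (λ row → ℤ.+-identityˡ (dot row y)) (Aₙ m))) ⟩
  tabulate (λ i → y₀ - lookup y i) ++ (Aₙ m · y) ∎
  where
  firstRow : Fin m → Vec ℤ (suc m)
  firstRow i = 1ℤ ∷ map -_ (unit i)
  dotY : Vec ℤ (suc m) → ℤ
  dotY row = dot row (y₀ ∷ y)
  first : ∀ i → dotY (firstRow i) ≡ y₀ - lookup y i
  first i = cong₂ _+ℤ_ (ℤ.*-identityˡ y₀) (trans (dot-negˡ (unit i) y) (cong -_ (dot-unit i y)))

combineRows-firstRows : (w : Vec ℤ m) →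
                        combineRows (tabulate λ i → 1ℤ ∷ map -_ (unit i)) w ≡ sum (lookup w) ∷ map -_ w
combineRows-firstRows {m} w = lookup-ext entry
  where
  T : Matrix m (suc m)
  T = tabulate λ i → 1ℤ ∷ map -_ (unit i)
  lookup-T : ∀ r j → lookup (lookup T r) j ≡ lookup (1ℤ ∷ map -_ (unit r)) j
  lookup-T r j = cong (λ row → lookup row j) (Vec.lookup∘tabulate (λ i → 1ℤ ∷ map -_ (unit i)) r)
  entry : ∀ j → lookup (combineRows T w) j ≡ lookup (sum (lookup w) ∷ map -_ w) j
  entry Fin.zero = begin
    lookup (combineRows T w) Fin.zero               ≡⟨ lookup-combineRows T w Fin.zero ⟩
    sum (λ r → lookup (lookup T r) Fin.zero *ℤ lookup w r)
      ≡⟨ sum-cong-≗ (λ r → trans (cong (_*ℤ lookup w r) (lookup-T r Fin.zero)) (ℤ.*-identityˡ (lookup w r))) ⟩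
    sum (lookup w)                                  ∎
  entry (Fin.suc j) = begin
    lookup (combineRows T w) (Fin.suc j)             ≡⟨ lookup-combineRows T w (Fin.suc j) ⟩
    sum (λ r → lookup (lookup T r) (Fin.suc j) *ℤ lookup w r)
      ≡⟨ sum-cong-≗ negate-unit ⟩
    sum (λ r → lookup (unit r) j *ℤ - lookup w r)    ≡⟨ sum-unit j (-_ ∘ lookup w) ⟩
    - lookup w j                                      ≡⟨ Vec.lookup-map j -_ w ⟨
    lookup (map -_ w) j                               ∎
    where
    negate-unit : ∀ r → lookup (lookup T r) (Fin.suc j) *ℤ lookup w r ≡ lookup (unit r) j *ℤ - lookup w r
    negate-unit r = begin
      lookup (lookup T r) (Fin.suc j) *ℤ lookup w r ≡⟨ cong (_*ℤ lookup w r) (trans (lookup-T r (Fin.suc j)) (Vec.lookup-map j -_ (unit r))) ⟩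
      - lookup (unit r) j *ℤ lookup w r            ≡⟨ ℤ.neg-distribˡ-* (lookup (unit r) j) (lookup w r) ⟨
      - (lookup (unit r) j *ℤ lookup w r)          ≡⟨ ℤ.neg-distribʳ-* (lookup (unit r) j) (lookup w r) ⟩
      lookup (unit r) j *ℤ - lookup w r            ∎

signSums : Vec ℤ m → Vec ℤ m
signSums y = tabulate λ i → sum λ j → sgn (lookup y i - lookup y j)

sgn-neg : ∀ z → sgn (- z) ≡ - sgn z
sgn-neg +0       = refl
sgn-neg +[1+ _ ] = refl
sgn-neg -[1+ _ ] = refl

combineRows-Aₙ : (y : Vec ℤ m) → combineRows (Aₙ m) (sgnᵥ (Aₙ m · y)) ≡ signSums y
combineRows-Aₙ {zero}  []       = refl
combineRows-Aₙ {suc m} (y₀ ∷ y) = begin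
  combineRows (Aₙ (suc m)) (sgnᵥ (Aₙ (suc m) · (y₀ ∷ y)))
    ≡⟨ cong (combineRows (Aₙ (suc m)) ∘ sgnᵥ) (Aₙ-suc-· y₀ y) ⟩
  combineRows (Aₙ (suc m)) (sgnᵥ (d ++ (Aₙ m · y)))
    ≡⟨ cong (combineRows (Aₙ (suc m))) (Vec.map-++ sgn d (Aₙ m · y)) ⟩
  combineRows (T ++ map (0ℤ ∷_) (Aₙ m)) (sgnᵥ d ++ sgnᵥ (Aₙ m · y))
    ≡⟨ combineRows-++ T (map (0ℤ ∷_) (Aₙ m)) (sgnᵥ d) (sgnᵥ (Aₙ m · y)) ⟩
  zipWith _+ℤ_ (combineRows T (sgnᵥ d)) (combineRows (map (0ℤ ∷_) (Aₙ m)) (sgnᵥ (Aₙ m · y)))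
    ≡⟨ cong₂ (zipWith _+ℤ_) (combineRows-firstRows (sgnᵥ d))
                            (trans (combineRows-padˡ 1 (Aₙ m) (sgnᵥ (Aₙ m · y))) (cong (0ℤ ∷_) (combineRows-Aₙ y))) ⟩
  (sum (lookup (sgnᵥ d)) +ℤ 0ℤ) ∷ zipWith _+ℤ_ (map -_ (sgnᵥ d)) (signSums y)
    ≡⟨ cong₂ _∷_ head (lookup-ext tail) ⟩
  signSums (y₀ ∷ y) ∎
  where
  d = tabulate λ i → y₀ - lookup y i
  T = tabulate λ i → 1ℤ ∷ map -_ (unit i)
  lookup-sgn-d : ∀ i → lookup (sgnᵥ d) i ≡ sgn (y₀ - lookup y i)
  lookup-sgn-d i = trans (Vec.lookup-map i sgn d) (cong sgn (Vec.lookup∘tabulate (λ i → y₀ - lookup y i) i))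
  head : sum (lookup (sgnᵥ d)) +ℤ 0ℤ ≡ sgn (y₀ - y₀) +ℤ sum (λ j → sgn (y₀ - lookup y j))
  head = begin
    sum (lookup (sgnᵥ d)) +ℤ 0ℤ                    ≡⟨ ℤ.+-identityʳ _ ⟩
    sum (lookup (sgnᵥ d))                          ≡⟨ sum-cong-≗ lookup-sgn-d ⟩
    sum (λ j → sgn (y₀ - lookup y j))              ≡⟨ ℤ.+-identityˡ _ ⟨
    0ℤ +ℤ sum (λ j → sgn (y₀ - lookup y j))        ≡⟨ cong (λ z → sgn z +ℤ sum (λ j → sgn (y₀ - lookup y j))) (ℤ.+-inverseʳ y₀) ⟨
    sgn (y₀ - y₀) +ℤ sum (λ j → sgn (y₀ - lookup y j)) ∎
  tail : ∀ i → lookup (zipWith _+ℤ_ (map -_ (sgnᵥ d)) (signSums y)) i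
             ≡ lookup (signSums (y₀ ∷ y)) (Fin.suc i)
  tail i = begin
    lookup (zipWith _+ℤ_ (map -_ (sgnᵥ d)) (signSums y)) i
      ≡⟨ Vec.lookup-zipWith _+ℤ_ i (map -_ (sgnᵥ d)) (signSums y) ⟩
    lookup (map -_ (sgnᵥ d)) i +ℤ lookup (signSums y) i
      ≡⟨ cong₂ _+ℤ_ (trans (Vec.lookup-map i -_ (sgnᵥ d)) (cong -_ (lookup-sgn-d i)))
                    (Vec.lookup∘tabulate (λ i → sum λ j → sgn (lookup y i - lookup y j)) i) ⟩
    - sgn (y₀ - lookup y i) +ℤ sum (λ j → sgn (lookup y i - lookup y j))
      ≡⟨ cong (_+ℤ sum (λ j → sgn (lookup y i - lookup y j))) (trans (sym (sgn-neg _)) (cong sgn (antisym y₀ (lookup y i)))) ⟩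
    sgn (lookup y i - y₀) +ℤ sum (λ j → sgn (lookup y i - lookup y j))
      ≡⟨ Vec.lookup∘tabulate (λ i → sum λ j → sgn (lookup (y₀ ∷ y) i - lookup (y₀ ∷ y) j)) (Fin.suc i) ⟨
    lookup (signSums (y₀ ∷ y)) (Fin.suc i) ∎
    where
    antisym : ∀ a b → - (a - b) ≡ b - a
    antisym = solve-∀

AllNonzero : Vec ℤ m → Set
AllNonzero = All (_≢ 0ℤ)

InRange : ℕ → ℤ → Set
InRange n z = (+ 1 ≤ℤ z) × (z ≤ℤ + n)

inRange⇒fin : ∀ {n z} → InRange n z → ∃ λ (a : Fin n) → z ≡ + suc (toℕ a)
inRange⇒fin {z = +[1+ t ]} (_ , t<n) = Fin.fromℕ< (ℤ.drop‿+≤+ t<n) , cong (+_ ∘ suc) (sym (Fin.toℕ-fromℕ< _))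
inRange⇒fin {z = +0}       (ℤ.+≤+ () , _)
inRange⇒fin {z = -[1+ _ ]} (() , _)

Aₙ-nonzero⇒injective : (y : Vec ℤ m) → AllNonzero (Aₙ m · y) → Injective _≡_ _≡_ (lookup y)
Aₙ-nonzero⇒injective {suc m} (y₀ ∷ y) nonzero = injective
  where
  nonzero′ = All.++⁻ (tabulate λ i → y₀ - lookup y i) (subst AllNonzero (Aₙ-suc-· y₀ y) nonzero)
  y₀≢ : ∀ i → y₀ ≢ lookup y i
  y₀≢ i y₀≡yᵢ = All.tabulate⁻ (proj₁ nonzero′) i (trans (cong (λ z → y₀ - z) (sym y₀≡yᵢ)) (ℤ.+-inverseʳ y₀))
  injective : Injective _≡_ _≡_ (lookup (y₀ ∷ y))
  injective {Fin.zero}  {Fin.zero}  _  = refl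
  injective {Fin.zero}  {Fin.suc j} eq = ⊥-elim (y₀≢ j eq)
  injective {Fin.suc i} {Fin.zero}  eq = ⊥-elim (y₀≢ i (sym eq))
  injective {Fin.suc i} {Fin.suc j} eq = cong Fin.suc (Aₙ-nonzero⇒injective y (proj₂ nonzero′) eq)

SignIdentity : Matrix r c → ℤ → Vec ℤ c → Set
SignIdentity M k y = map (+ 2 *ℤ_) y ≡ zipWith _+ℤ_ ((M ᵀ) · sgnᵥ (M · y)) (replicate _ k)

signIdentity-Aₙ : (n : ℕ) (y : Vec ℤ n) → All (InRange n) y → AllNonzero (Aₙ n · y) →
                  SignIdentity (Aₙ n) (+ suc n) y
signIdentity-Aₙ n y inRange nonzero = lookup-ext entry
  where
  value : Fin n → Fin n
  value i = proj₁ (inRange⇒fin (All.lookup⁺ inRange i))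
  y≡value : ∀ i → lookup y i ≡ + suc (toℕ (value i))
  y≡value i = proj₂ (inRange⇒fin (All.lookup⁺ inRange i))
  value-injective : Injective _≡_ _≡_ value
  value-injective {i} {j} eq =
    Aₙ-nonzero⇒injective y nonzero (trans (y≡value i) (trans (cong (+_ ∘ suc ∘ toℕ) eq) (sym (y≡value j))))
  entry : ∀ i → lookup (map (+ 2 *ℤ_) y) i
              ≡ lookup (zipWith _+ℤ_ ((Aₙ n ᵀ) · sgnᵥ (Aₙ n · y)) (replicate n (+ suc n))) i
  entry i = begin
    lookup (map (+ 2 *ℤ_) y) i
      ≡⟨ Vec.lookup-map i (+ 2 *ℤ_) y ⟩
    + 2 *ℤ lookup y i
      ≡⟨ cong (+ 2 *ℤ_) (y≡value i) ⟩
    + 2 *ℤ + suc t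
      ≡⟨ sum-sgn-1…n n t (Fin.toℕ<n (value i)) ⟨
    sum {n} (λ a → sgn (+ suc t - + suc (toℕ a))) +ℤ + suc n
      ≡⟨ cong (_+ℤ + suc n) (sum-∘-injective (λ a → sgn (+ suc t - + suc (toℕ a))) value-injective) ⟨
    sum (λ j → sgn (+ suc t - + suc (toℕ (value j)))) +ℤ + suc n
      ≡⟨ cong (_+ℤ + suc n) (sum-cong-≗ {n} λ j → cong₂ (λ a b → sgn (a - b)) (y≡value i) (y≡value j)) ⟨
    sum (λ j → sgn (lookup y i - lookup y j)) +ℤ + suc n
      ≡⟨ cong₂ _+ℤ_ (Vec.lookup∘tabulate (λ i → sum λ j → sgn (lookup y i - lookup y j)) i) (Vec.lookup-replicate i (+ suc n)) ⟨
    lookup (signSums y) i +ℤ lookup (replicate n (+ suc n)) i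
      ≡⟨ cong (λ v → lookup v i +ℤ lookup (replicate n (+ suc n)) i)
              (trans (ᵀ·≡combineRows (Aₙ n) (sgnᵥ (Aₙ n · y))) (combineRows-Aₙ y)) ⟨
    lookup ((Aₙ n ᵀ) · sgnᵥ (Aₙ n · y)) i +ℤ lookup (replicate n (+ suc n)) i
      ≡⟨ Vec.lookup-zipWith _+ℤ_ i ((Aₙ n ᵀ) · sgnᵥ (Aₙ n · y)) (replicate n (+ suc n)) ⟨
    lookup (zipWith _+ℤ_ ((Aₙ n ᵀ) · sgnᵥ (Aₙ n · y)) (replicate n (+ suc n))) i ∎
    where t = toℕ (value i)

signIdentity-blockDiag : (M : Matrix r c) (P : ℤ → Set) (k : ℤ) →
  (∀ u → All P u → AllNonzero (M · u) → SignIdentity M k u) →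
  (b : ℕ) (y : Vec ℤ (b * c)) → All P y → AllNonzero (blockDiag b M · y) → SignIdentity (blockDiag b M) k y
signIdentity-blockDiag M P k block zero    [] _ _ = refl
signIdentity-blockDiag {c = c} M P k block (suc b) y inP nonzero with splitAt c y
... | u , v , refl = begin
  map (+ 2 *ℤ_) (u ++ v)
    ≡⟨ Vec.map-++ (+ 2 *ℤ_) u v ⟩
  map (+ 2 *ℤ_) u ++ map (+ 2 *ℤ_) v
    ≡⟨ cong₂ _++_ (block u (proj₁ inP′) (proj₁ nonzero′))
                  (signIdentity-blockDiag M P k block b v (proj₂ inP′) (proj₂ nonzero′)) ⟩
  zipWith _+ℤ_ (Mᵀs) (replicate c k) ++ zipWith _+ℤ_ (Bᵀs) (replicate (b * c) k)
    ≡⟨ Vec.zipWith-++ _+ℤ_ Mᵀs Bᵀs (replicate c k) (replicate (b * c) k) ⟨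
  zipWith _+ℤ_ (Mᵀs ++ Bᵀs) (replicate c k ++ replicate (b * c) k)
    ≡⟨ cong₂ (zipWith _+ℤ_) (sym transposed) (sym (replicate-++ {m = c} k)) ⟩
  zipWith _+ℤ_ ((blockDiag (suc b) M ᵀ) · sgnᵥ (blockDiag (suc b) M · (u ++ v))) (replicate (c ℕ.+ b * c) k) ∎
  where
  B = blockDiag b M
  Mᵀs = (M ᵀ) · sgnᵥ (M · u)
  Bᵀs = (B ᵀ) · sgnᵥ (B · v)
  inP′ = All.++⁻ u inP
  nonzero′ = All.++⁻ (M · u) (subst AllNonzero (·-blockDiag b M u v) nonzero)
  transposed : (blockDiag (suc b) M ᵀ) · sgnᵥ (blockDiag (suc b) M · (u ++ v)) ≡ Mᵀs ++ Bᵀs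
  transposed = begin
    (blockDiag (suc b) M ᵀ) · sgnᵥ (blockDiag (suc b) M · (u ++ v))
      ≡⟨ cong (λ z → (blockDiag (suc b) M ᵀ) · sgnᵥ z) (·-blockDiag b M u v) ⟩
    (blockDiag (suc b) M ᵀ) · sgnᵥ ((M · u) ++ (B · v))
      ≡⟨ cong ((blockDiag (suc b) M ᵀ) ·_) (Vec.map-++ sgn (M · u) (B · v)) ⟩
    (blockDiag (suc b) M ᵀ) · (sgnᵥ (M · u) ++ sgnᵥ (B · v))
      ≡⟨ ᵀ·-blockDiag b M (sgnᵥ (M · u)) (sgnᵥ (B · v)) ⟩
    Mᵀs ++ Bᵀs ∎

theorem1 : (n : ℕ) → 2 ≤ n → (π : Permutation′ (n * n)) → (x : Vec ℤ (n * n)) →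
    All (λ xi → (+ 1 ≤ℤ xi) × (xi ≤ℤ + n)) x →
    All (λ yi → yi ≢ + 0) (Aπ n π · x) →
    map (λ xi → + 2 *ℤ xi) x
      ≡ zipWith _+ℤ_ ((Aπ n π ᵀ) · sgnᵥ (Aπ n π · x)) (replicate (n * n) (+ (suc n)))
theorem1 n _ π x inRange nonzero = begin
  map (+ 2 *ℤ_) x
    ≡⟨ cong (map (+ 2 *ℤ_)) (rearrange-inverse ρ σ (λ _ → Perm.inverseʳ π) x) ⟨
  map (+ 2 *ℤ_) (rearrange σ y)
    ≡⟨ rearrange-map σ (+ 2 *ℤ_) y ⟨
  rearrange σ (map (+ 2 *ℤ_) y)
    ≡⟨ cong (rearrange σ) (signIdentity-blockDiag (Aₙ n) (InRange n) (+ suc n) (signIdentity-Aₙ n) n y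
                             (All.tabulate⁺ (All.lookup⁺ inRange ∘ ρ))
                             (subst AllNonzero (·-permuteColumns π (A n) x) nonzero)) ⟩
  rearrange σ (zipWith _+ℤ_ ((A n ᵀ) · sgnᵥ (A n · y)) (replicate (n * n) (+ suc n)))
    ≡⟨ rearrange-zipWith σ _+ℤ_ ((A n ᵀ) · sgnᵥ (A n · y)) (replicate (n * n) (+ suc n)) ⟩
  zipWith _+ℤ_ (rearrange σ ((A n ᵀ) · sgnᵥ (A n · y))) (rearrange σ (replicate (n * n) (+ suc n)))
    ≡⟨ cong₂ (zipWith _+ℤ_) (sym (ᵀ·-permuteColumns σ (A n) (sgnᵥ (A n · y)))) (rearrange-replicate σ (+ suc n)) ⟩
  zipWith _+ℤ_ ((Aπ n π ᵀ) · sgnᵥ (A n · y)) (replicate (n * n) (+ suc n))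
    ≡⟨ cong (λ z → zipWith _+ℤ_ ((Aπ n π ᵀ) · sgnᵥ z) (replicate (n * n) (+ suc n))) (·-permuteColumns π (A n) x) ⟨
  zipWith _+ℤ_ ((Aπ n π ᵀ) · sgnᵥ (Aπ n π · x)) (replicate (n * n) (+ suc n)) ∎
  where
  ρ = π ⟨$⟩ʳ_
  σ = π ⟨$⟩ˡ_
  y = rearrange ρ x
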